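{- Let $S$ be an admissible pinnacle set and let $x \in S$. If $|S_x| = |\overline{S}_x| - 1$, where $S_x = [1,x]\cap S$ and $\overline{S}_x = [1,x]\setminus S$, then $S_x$ is uninterrupted in every admissible ordering of $S$.
   Context: A permutation $w = w(1)\cdots w(n)$ of $[n]$ has a pinnacle $w(i)$ whenever $i\in[2,n-1]$ and $w(i-1) < w(i) > w(i+1)$. A set $S$ is an admissible pinnacle set if some permutation has pinnacle set exactly $S$. An ordering of $S$ is admissible if there is a permutation with pinnacle set $S$ whose pinnacles appear left to right in that order. For $T\subseteq S$ and an ordering $\mathcal{A}$ of $S$, write $\mathcal{A}$ as a word $a_0 t_1 a_1 \cdots a_{k-1} t_k a_k$ with each $t_i$ a nonempty word of elements of $T$, each $a_i$ a word of elements of $S\setminus T$, and only $a_0,a_k$ possibly empty; $T$ is interrupted $k-1$ times, and is uninterrupted if $k=1$. -}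

module Defs where

open import Data.Bool using (Bool; _∧_; if_then_else_)
open import Data.Nat using (ℕ; suc; _<ᵇ_; _≤_; _<_; _<?_; _≤?_; _≟_)
open import Data.List using (List; []; _∷_; _++_; length; filter; applyUpTo)
open import Data.List.Membership.Propositional using (_∈_; _∉_)
open import Data.List.Membership.DecPropositional _≟_ using (_∈?_)
open import Data.List.Relation.Unary.All using (All)
open import Data.List.Relation.Unary.Unique.Propositional using (Unique)
open import Data.List.Relation.Binary.Permutation.Propositional using (_↭_)
open import Data.Product using (Σ; ∃; _×_; _,_)
open import Relation.Nullary using (¬_; yes; no)
open import Relation.Nullary.Decidable using (¬?)
open import Relation.Binary.PropositionalEquality using (_≡_)

range1 : ℕ → List ℕ
range1 n = applyUpTo suc n

IsPerm : ℕ → List ℕ → Set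
IsPerm n w = w ↭ range1 n

isPinnacle : ℕ → ℕ → ℕ → Bool
isPinnacle a b c = (a <ᵇ b) ∧ (c <ᵇ b)

pinnacles : List ℕ → List ℕ
pinnacles [] = []
pinnacles (a ∷ []) = []
pinnacles (a ∷ b ∷ []) = []
pinnacles (a ∷ rest@(b ∷ c ∷ _)) =
  if isPinnacle a b c then b ∷ pinnacles rest else pinnacles rest

-- A finite set S ⊆ ℕ is represented by a duplicate-free list.
-- w has pinnacle set exactly S
HasPinnacleSet : List ℕ → List ℕ → Set
HasPinnacleSet w S = ∀ y → (y ∈ pinnacles w → y ∈ S) × (y ∈ S → y ∈ pinnacles w)

AdmissiblePinnacleSet : List ℕ → Set
AdmissiblePinnacleSet S = Unique S × ∃ λ n → Σ (List ℕ) λ w → IsPerm n w × HasPinnacleSet w S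

IsOrdering : List ℕ → List ℕ → Set
IsOrdering S A = A ↭ S

AdmissibleOrdering : List ℕ → List ℕ → Set
AdmissibleOrdering S A =
  IsOrdering S A × ∃ λ n → Σ (List ℕ) λ w → IsPerm n w × HasPinnacleSet w S × pinnacles w ≡ A

Sx : List ℕ → ℕ → List ℕ
Sx S x = filter (λ y → y ≤? x) S

SbarX : List ℕ → ℕ → List ℕ
SbarX S x = filter (λ y → ¬? (y ∈? S)) (range1 x)

Uninterrupted : List ℕ → List ℕ → Set
Uninterrupted T A =
  Σ (List ℕ) λ a₀ → Σ (List ℕ) λ t → Σ (List ℕ) λ a₁ →
    (A ≡ a₀ ++ t ++ a₁) × ¬ (t ≡ []) × All (_∈ T) t × All (_∉ T) a₀ × All (_∉ T) a₁

-- Call a value small if it is at most x. A small pinnacle has two smaller, hence small,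
-- neighbours, and these are non-pinnacles. Reading the pinnacles of w left to right, a
-- maximal run of k small pinnacles is therefore flanked by k + 1 small non-pinnacles, and
-- distinct runs are separated by a large pinnacle, so they use disjoint non-pinnacles. The
-- small non-pinnacles of a permutation of [n] with pinnacle set S lie in S̄ₓ, so
-- |Sₓ| + (number of runs) ≤ |S̄ₓ| = |Sₓ| + 1. Since x is itself a small pinnacle, there is
-- exactly one run: Sₓ is uninterrupted.
module Submission where

open import Defs
open import Data.Bool using (true; false; if_then_else_)
open import Data.Bool.Properties using (T-∧; T-≡)
open import Data.Nat using (ℕ; zero; suc; _+_; _≤_; _<_; _≤?_; _≟_; z≤n; s≤s)
open import Data.Nat.Properties
open import Data.List using (List; []; _∷_; _++_; [_]; length; filter)
open import Data.List.Properties using (filter-accept; filter-reject; filter-++; filter-all; length-++; applyUpTo-∷ʳ; ++-identityʳ)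
open import Data.List.Membership.Propositional using (_∈_; _∉_; lose)
open import Data.List.Membership.DecPropositional _≟_ using (_∈?_)
open import Data.List.Membership.Propositional.Properties using (∈-filter⁺; ∈-filter⁻; ∈-++⁺ˡ; ∈-++⁺ʳ; ∈-applyUpTo⁻)
open import Data.List.Relation.Unary.All as All using (All; []; _∷_)
import Data.List.Relation.Unary.All.Properties as All
open import Data.List.Relation.Unary.Any using (Any; here; there)
open import Data.List.Relation.Unary.AllPairs using (_∷_)
open import Data.List.Relation.Unary.Unique.Propositional using (Unique)
open import Data.List.Relation.Unary.Unique.Propositional.Properties using (applyUpTo⁺₁)
open import Data.List.Relation.Binary.Permutation.Propositional using (_↭_; prep; ↭-refl; ↭-sym; ↭-trans; ↭⇒↭ₛ)
open import Data.List.Relation.Binary.Permutation.Propositional.Properties using (shift; filter-↭; ↭-length; ∈-resp-↭)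
open import Data.List.Relation.Binary.Permutation.Setoid.Properties using (Unique-resp-↭)
open import Data.Product using (Σ; _×_; _,_; proj₁; proj₂)
import Data.Product as Product
open import Data.Sum using (inj₁; inj₂)
open import Function.Bundles using (Equivalence)
open import Relation.Nullary using (¬_; yes; no; does; contradiction)
open import Relation.Unary using (Pred; Decidable)
open import Relation.Nullary.Decidable using (¬?)
open import Relation.Binary.PropositionalEquality using (_≡_; refl; sym; trans; cong; cong₂; subst₂; setoid; module ≡-Reasoning)

isPinnacle⇒< : ∀ {a b c} → isPinnacle a b c ≡ true → a < b × c < b
isPinnacle⇒< {a} {b} {c} e =
  Product.map (<ᵇ⇒< a b) (<ᵇ⇒< c b) (Equivalence.to T-∧ (Equivalence.from T-≡ e))

tailNonpinnacles : List ℕ → List ℕ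
tailNonpinnacles [] = []
tailNonpinnacles (a ∷ []) = []
tailNonpinnacles (a ∷ b ∷ []) = b ∷ []
tailNonpinnacles (a ∷ rest@(b ∷ c ∷ _)) =
  if isPinnacle a b c then tailNonpinnacles rest else b ∷ tailNonpinnacles rest

nonpinnacles : List ℕ → List ℕ
nonpinnacles [] = []
nonpinnacles (a ∷ r) = a ∷ tailNonpinnacles (a ∷ r)

↭-pinnacles++tailNonpinnacles : ∀ a r → r ↭ pinnacles (a ∷ r) ++ tailNonpinnacles (a ∷ r)
↭-pinnacles++tailNonpinnacles a [] = ↭-refl
↭-pinnacles++tailNonpinnacles a (b ∷ []) = ↭-refl
↭-pinnacles++tailNonpinnacles a (b ∷ c ∷ r)
  with isPinnacle a b c | ↭-pinnacles++tailNonpinnacles b (c ∷ r)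
... | true | c∷r↭ = prep b c∷r↭
... | false | c∷r↭ = ↭-trans (prep b c∷r↭)
                      (↭-sym (shift b (pinnacles (b ∷ c ∷ r)) (tailNonpinnacles (b ∷ c ∷ r))))

↭-pinnacles++nonpinnacles : ∀ w → w ↭ pinnacles w ++ nonpinnacles w
↭-pinnacles++nonpinnacles [] = ↭-refl
↭-pinnacles++nonpinnacles (a ∷ r) =
  ↭-trans (prep a (↭-pinnacles++tailNonpinnacles a r))
          (↭-sym (shift a (pinnacles (a ∷ r)) (tailNonpinnacles (a ∷ r))))

range1-unique : ∀ n → Unique (range1 n)
range1-unique n = applyUpTo⁺₁ suc n (λ i<j _ eq → <⇒≢ i<j (suc-injective eq))

∈-range1⇒≤ : ∀ {y n} → y ∈ range1 n → y ≤ n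
∈-range1⇒≤ y∈ with _ , i<n , refl ← ∈-applyUpTo⁻ suc y∈ = i<n

pinnacle≤n : ∀ {n w y} → IsPerm n w → y ∈ pinnacles w → y ≤ n
pinnacle≤n {w = w} w↭[n] y∈P =
  ∈-range1⇒≤ (∈-resp-↭ w↭[n] (∈-resp-↭ (↭-sym (↭-pinnacles++nonpinnacles w)) (∈-++⁺ˡ y∈P)))

descent-pinnacles : ∀ {b c} r → c < b →
  pinnacles (b ∷ c ∷ r) ≡ pinnacles (c ∷ r) × tailNonpinnacles (b ∷ c ∷ r) ≡ c ∷ tailNonpinnacles (c ∷ r)
descent-pinnacles [] c<b = refl , refl
descent-pinnacles {b} {c} (d ∷ r) c<b with isPinnacle b c d in e
... | true = contradiction (proj₁ (isPinnacle⇒< e)) (<-asym c<b)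
... | false = refl , refl

Unique-++⇒disjoint : ∀ {y : ℕ} xs {ys} → Unique (xs ++ ys) → y ∈ xs → y ∉ ys
Unique-++⇒disjoint (_ ∷ xs) (x∉ ∷ _) (here refl) y∈ys = All.lookup x∉ (∈-++⁺ʳ xs y∈ys) refl
Unique-++⇒disjoint (_ ∷ xs) (_ ∷ unique) (there y∈xs) = Unique-++⇒disjoint xs unique y∈xs

filter-≤-range1 : ∀ {x n} → x ≤ n → filter (_≤? x) (range1 n) ≡ range1 x
filter-≤-range1 {n = zero} z≤n = refl
filter-≤-range1 {x} {suc n} x≤1+n with m≤n⇒m<n∨m≡n x≤1+n
... | inj₂ refl = filter-all (_≤? x) (All.tabulate ∈-range1⇒≤)
... | inj₁ x<1+n = begin
  filter (_≤? x) (range1 (suc n))                     ≡⟨ cong (filter (_≤? x)) (applyUpTo-∷ʳ suc n) ⟨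
  filter (_≤? x) (range1 n ++ [ suc n ])              ≡⟨ filter-++ (_≤? x) (range1 n) [ suc n ] ⟩
  filter (_≤? x) (range1 n) ++ filter (_≤? x) [ suc n ]
    ≡⟨ cong₂ _++_ (filter-≤-range1 (≤-pred x<1+n)) (filter-reject (_≤? x) (<⇒≱ x<1+n)) ⟩
  range1 x ++ []                                      ≡⟨ ++-identityʳ (range1 x) ⟩
  range1 x                                            ∎
  where open ≡-Reasoning

module Runs {ℓ} {Small : Pred ℕ ℓ} (small? : Decidable Small) where

  #small : List ℕ → ℕ
  #small L = length (filter small? L)

  #small-accept : ∀ {a L} → Small a → #small (a ∷ L) ≡ suc (#small L)
  #small-accept small-a = cong length (filter-accept small? small-a)

  #small-∷ : ∀ a L → #small L ≤ #small (a ∷ L)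
  #small-∷ a L with small? a
  ... | yes _ = n≤1+n (#small L)
  ... | no _ = ≤-refl

  -- runs P counts the maximal runs of small entries of P; runsAfterSmall P does the same
  -- for P preceded by a small entry, so that a leading run of P is not counted again.
  runs runsAfterSmall : List ℕ → ℕ
  runs [] = 0
  runs (p ∷ ps) = if does (small? p) then suc (runsAfterSmall ps) else runs ps
  runsAfterSmall [] = 0
  runsAfterSmall (p ∷ ps) = if does (small? p) then runsAfterSmall ps else runs ps

  -- For P the pinnacles and N the tail non-pinnacles of a word a ∷ r. The second component
  -- applies when a is the right neighbour of a small pinnacle already counted.
  RunBound : ℕ → List ℕ → List ℕ → Set
  RunBound a P N = #small P + runs P ≤ #small (a ∷ N) × #small P + runsAfterSmall P ≤ #small N

  RunBound-nonpinnacle : ∀ a b P N → RunBound b P N → RunBound a P (b ∷ N)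
  RunBound-nonpinnacle a b P N (bound , boundAfterSmall) =
    ≤-trans bound (#small-∷ a (b ∷ N)) , ≤-trans boundAfterSmall (#small-∷ b N)

  module _ (downward : ∀ {a b} → a < b → Small b → Small a) where

    RunBound-pinnacle : ∀ {a b c} P N → a < b → c < b → RunBound c P N → RunBound a (b ∷ P) (c ∷ N)
    RunBound-pinnacle {a} {b} {c} P N a<b c<b (bound , boundAfterSmall) with small? b
    ... | no _ = ≤-trans bound (#small-∷ a (c ∷ N)) , bound
    ... | yes small-b = bound′ , ≤-trans (s≤s boundAfterSmall) (≤-reflexive (sym (#small-accept small-c)))
      where
      open ≤-Reasoning
      small-c : Small c
      small-c = downward c<b small-b
      bound′ : suc (#small P) + suc (runsAfterSmall P) ≤ #small (a ∷ c ∷ N)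
      bound′ = begin
        suc (#small P) + suc (runsAfterSmall P)  ≡⟨ cong suc (+-suc (#small P) (runsAfterSmall P)) ⟩
        suc (suc (#small P + runsAfterSmall P))  ≤⟨ s≤s (s≤s boundAfterSmall) ⟩
        suc (suc (#small N))                     ≡⟨ cong suc (#small-accept small-c) ⟨
        suc (#small (c ∷ N))                     ≡⟨ #small-accept (downward a<b small-b) ⟨
        #small (a ∷ c ∷ N)                       ∎

    runBound : ∀ a r → RunBound a (pinnacles (a ∷ r)) (tailNonpinnacles (a ∷ r))
    runBound a [] = z≤n , z≤n
    runBound a (b ∷ []) = z≤n , z≤n
    runBound a (b ∷ c ∷ r) with isPinnacle a b c in e | runBound b (c ∷ r) | runBound c r
    ... | false | bound-b | _ =
      RunBound-nonpinnacle a b (pinnacles (b ∷ c ∷ r)) (tailNonpinnacles (b ∷ c ∷ r)) bound-b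
    ... | true | _ | bound-c with a<b , c<b ← isPinnacle⇒< e =
      subst₂ (λ P N → RunBound a (b ∷ P) N) (sym pinnacles-eq) (sym tail-eq)
        (RunBound-pinnacle _ _ a<b c<b bound-c)
      where pinnacles-eq = proj₁ (descent-pinnacles r c<b)
            tail-eq = proj₂ (descent-pinnacles r c<b)

    #small-pinnacles+runs≤#small-nonpinnacles : ∀ w →
      #small (pinnacles w) + runs (pinnacles w) ≤ #small (nonpinnacles w)
    #small-pinnacles+runs≤#small-nonpinnacles [] = z≤n
    #small-pinnacles+runs≤#small-nonpinnacles (a ∷ r) = proj₁ (runBound a r)

  #small-nonpinnacles≤ : ∀ {S n w} → IsPerm n w → HasPinnacleSet w S →
    #small (nonpinnacles w) ≤ length (filter (λ y → ¬? (y ∈? S)) (filter small? (range1 n)))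
  #small-nonpinnacles≤ {S} {n} {w} w↭[n] pinnacles≈S = begin
    #small N                       ≡⟨ cong length (filter-all notInS? (All.filter⁺ small? N∉S)) ⟨
    length (F N)                   ≤⟨ m≤n+m (length (F N)) (length (F P)) ⟩
    length (F P) + length (F N)    ≡⟨ length-++ (F P) ⟨
    length (F P ++ F N)            ≡⟨ cong length F-++ ⟨
    length (F (P ++ N))            ≡⟨ ↭-length (filter-↭ notInS? (filter-↭ small? P++N↭[n])) ⟩
    length (F (range1 n))          ∎
    where
    open ≤-Reasoning
    P = pinnacles w
    N = nonpinnacles w
    notInS? = λ y → ¬? (y ∈? S)
    F : List ℕ → List ℕ
    F L = filter notInS? (filter small? L)
    F-++ : F (P ++ N) ≡ F P ++ F N
    F-++ = trans (cong (filter notInS?) (filter-++ small? P N))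
                 (filter-++ notInS? (filter small? P) (filter small? N))
    P++N↭[n] : P ++ N ↭ range1 n
    P++N↭[n] = ↭-trans (↭-sym (↭-pinnacles++nonpinnacles w)) w↭[n]
    N∉S : All (_∉ S) N
    N∉S = All.tabulate λ y∈N y∈S →
      Unique-++⇒disjoint P (Unique-resp-↭ (setoid ℕ) (↭⇒↭ₛ (↭-sym P++N↭[n])) (range1-unique n))
        (proj₂ (pinnacles≈S _) y∈S) y∈N

  module _ {S : List ℕ} where

    private
      ∈-small : ∀ {y} → y ∈ S → Small y → y ∈ filter small? S
      ∈-small = ∈-filter⁺ small?

      ∉-small : ∀ {y} → ¬ Small y → y ∉ filter small? S
      ∉-small ¬small-y y∈ = ¬small-y (proj₂ (∈-filter⁻ small? {xs = S} y∈))

    runs≡0⇒All∉ : ∀ A → runs A ≡ 0 → All (_∉ filter small? S) A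
    runs≡0⇒All∉ [] _ = []
    runs≡0⇒All∉ (p ∷ ps) runs≡0 with small? p
    runs≡0⇒All∉ (p ∷ ps) () | yes _
    ... | no ¬small-p = ∉-small ¬small-p ∷ runs≡0⇒All∉ ps runs≡0

    runsAfterSmall≡0⇒split : ∀ A → All (_∈ S) A → runsAfterSmall A ≡ 0 →
      Σ (List ℕ) λ t → Σ (List ℕ) λ a →
        A ≡ t ++ a × All (_∈ filter small? S) t × All (_∉ filter small? S) a
    runsAfterSmall≡0⇒split [] [] _ = [] , [] , refl , [] , []
    runsAfterSmall≡0⇒split (p ∷ ps) (p∈S ∷ ps⊆S) runs≡0 with small? p
    ... | no ¬small-p = [] , p ∷ ps , refl , [] , ∉-small ¬small-p ∷ runs≡0⇒All∉ ps runs≡0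
    ... | yes small-p with t , a , ps≡t++a , t⊆T , a∩T≡∅ ← runsAfterSmall≡0⇒split ps ps⊆S runs≡0 =
      p ∷ t , a , cong (p ∷_) ps≡t++a , ∈-small p∈S small-p ∷ t⊆T , a∩T≡∅

    runs≤1⇒Uninterrupted : ∀ A → All (_∈ S) A → Any Small A → runs A ≤ 1 →
      Uninterrupted (filter small? S) A
    runs≤1⇒Uninterrupted (p ∷ ps) (p∈S ∷ ps⊆S) small∈A runs≤1 with small? p
    ... | yes small-p
      with t , a , ps≡t++a , t⊆T , a∩T≡∅ ← runsAfterSmall≡0⇒split ps ps⊆S (n≤0⇒n≡0 (≤-pred runs≤1)) =
      [] , p ∷ t , a , cong (p ∷_) ps≡t++a , (λ ()) , ∈-small p∈S small-p ∷ t⊆T , [] , a∩T≡∅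
    ... | no ¬small-p with small∈A
    ...   | here small-p = contradiction small-p ¬small-p
    ...   | there small∈ps
      with a₀ , t , a₁ , ps≡ , t≢[] , t⊆T , a₀∩T≡∅ , a₁∩T≡∅ ← runs≤1⇒Uninterrupted ps ps⊆S small∈ps runs≤1 =
      p ∷ a₀ , t , a₁ , cong (p ∷_) ps≡ , t≢[] , t⊆T , ∉-small ¬small-p ∷ a₀∩T≡∅ , a₁∩T≡∅

lemma3p3 : (S : List ℕ) (x : ℕ) → AdmissiblePinnacleSet S → x ∈ S →
    suc (length (Sx S x)) ≡ length (SbarX S x) →
    ∀ (A : List ℕ) → AdmissibleOrdering S A → Uninterrupted (Sx S x) A
lemma3p3 S x _ x∈S size _ (A↭S , n , w , w↭[n] , pinnacles≈S , refl) =
  runs≤1⇒Uninterrupted (pinnacles w) (All.tabulate (proj₁ (pinnacles≈S _))) (lose x∈A ≤-refl) runs≤1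
  where
  open Runs (_≤? x)
  open ≤-Reasoning
  x∈A : x ∈ pinnacles w
  x∈A = proj₂ (pinnacles≈S x) x∈S
  runs≤1 : runs (pinnacles w) ≤ 1
  runs≤1 = +-cancelˡ-≤ (#small (pinnacles w)) (runs (pinnacles w)) 1 (begin
    #small (pinnacles w) + runs (pinnacles w)
      ≤⟨ #small-pinnacles+runs≤#small-nonpinnacles (λ a<b b≤x → <⇒≤ (<-≤-trans a<b b≤x)) w ⟩
    #small (nonpinnacles w)
      ≤⟨ #small-nonpinnacles≤ w↭[n] pinnacles≈S ⟩
    length (filter (λ y → ¬? (y ∈? S)) (filter (_≤? x) (range1 n)))
      ≡⟨ cong (λ L → length (filter (λ y → ¬? (y ∈? S)) L)) (filter-≤-range1 (pinnacle≤n w↭[n] x∈A)) ⟩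
    length (SbarX S x)        ≡⟨ size ⟨
    suc (length (Sx S x))     ≡⟨ cong suc (↭-length (filter-↭ (_≤? x) A↭S)) ⟨
    suc (#small (pinnacles w)) ≡⟨ +-comm 1 (#small (pinnacles w)) ⟩
    #small (pinnacles w) + 1  ∎)
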